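{- Let $p\ge 5$ be a prime. If a nontrivial regular $(v,k,\lambda,\mu)$-PDS exists in an Abelian group with $v=8p^3$, $\Delta=(\lambda-\mu)^2+4(k-\mu)=4p^2$ and $k\le v/2$, then $k\le p^2+\tfrac{p}{4}-\tfrac12$.
   Context: Let $G$ be a finite Abelian group of order $v$ with identity $e$, and $D\subseteq G$ a subset of size $k$. $D$ is a $(v,k,\lambda,\mu)$-partial difference set (PDS) in $G$ if the expressions $gh^{ -1}$ with $g,h\in D$, $g\neq h$, represent each non-identity element of $D$ exactly $\lambda$ times and each non-identity element of $G$ not in $D$ exactly $\mu$ times. $D$ is regular if moreover $D^{(-1)}=D$ and $e\notin D$. A regular PDS $D$ is trivial if $D\cup\{e\}$ or $G\setminus D$ is a subgroup of $G$. -}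

module Defs where

open import Level using (0ℓ)
open import Algebra.Bundles using (AbelianGroup)
open import Data.Nat using (ℕ; _+_; _*_; _≤_)
open import Data.Integer as ℤ using (ℤ; +_)
open import Data.List using (List; length; filter; cartesianProduct)
open import Data.List.Relation.Unary.Any using (Any)
open import Data.List.Relation.Unary.AllPairs using (AllPairs)
open import Data.Product using (_×_; _,_; proj₁; proj₂)
open import Data.Sum using (_⊎_)
open import Relation.Nullary using (¬_; _×-dec_; ¬?)
open import Relation.Unary using (Pred; Decidable)
import Relation.Binary as B

record FiniteAbelianGroup : Set₁ where
  field
    grp      : AbelianGroup 0ℓ 0ℓ
  open AbelianGroup grp public
  field
    _≟_      : B.Decidable _≈_
    elems    : List Carrier
    complete : ∀ x → Any (x ≈_) elems
    distinct : AllPairs (λ a b → ¬ (a ≈ b)) elems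

  order : ℕ
  order = length elems

record Subset (G : FiniteAbelianGroup) : Set₁ where
  open FiniteAbelianGroup G
  field
    mem      : Pred Carrier 0ℓ
    mem?     : Decidable mem
    respects : ∀ {x y} → x ≈ y → mem x → mem y

module _ {G : FiniteAbelianGroup} (D : Subset G) where
  open FiniteAbelianGroup G
  open Subset D

  size : ℕ
  size = length (filter mem? elems)

  reps : Carrier → ℕ
  reps x = length (filter P? (cartesianProduct elems elems))
    where
    P : Carrier × Carrier → Set
    P (g , h) = mem g × mem h × ¬ (g ≈ h) × ((g ∙ h ⁻¹) ≈ x)
    P? : Decidable P
    P? (g , h) = mem? g ×-dec mem? h ×-dec ¬? (g ≟ h) ×-dec ((g ∙ h ⁻¹) ≟ x)

  IsPDS : ℕ → ℕ → ℕ → ℕ → Set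
  IsPDS v k λ' μ =
    order ≡ℕ v × size ≡ℕ k ×
    (∀ x → ¬ (x ≈ ε) → mem x → reps x ≡ℕ λ') ×
    (∀ x → ¬ (x ≈ ε) → ¬ mem x → reps x ≡ℕ μ)
    where
    open import Relation.Binary.PropositionalEquality using () renaming (_≡_ to _≡ℕ_)

  IsRegular : Set
  IsRegular = (∀ x → mem x → mem (x ⁻¹)) × ¬ mem ε

IsSubgroup : (G : FiniteAbelianGroup) → Pred (FiniteAbelianGroup.Carrier G) 0ℓ → Set
IsSubgroup G S = S ε × (∀ x y → S x → S y → S (x ∙ y)) × (∀ x → S x → S (x ⁻¹))
  where open FiniteAbelianGroup G

IsTrivial : {G : FiniteAbelianGroup} → Subset G → Set
IsTrivial {G} D =
  IsSubgroup G (λ x → Subset.mem D x ⊎ (x ≈ ε)) ⊎ IsSubgroup G (λ x → ¬ Subset.mem D x)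
  where open FiniteAbelianGroup G

module Submission where

-- Only two consequences of the PDS axioms are used, both obtained by double counting
-- the differences g h⁻¹ (g ≠ h in D): with c the number of non-identity elements outside D,
--   (1) λk + μc ≤ k²      (every ordered pair of D is counted at most once), and
--   (2) v ≤ k + c + 1     (G = D ∪ {e} ∪ the c outside elements).
-- Writing d = |λ - μ|, the hypothesis Δ = 4p² reads d² + 4k = 4p² + 4μ in ℕ; together
-- with (1), (2) and 2k ≤ v this gives, for W = k + c ≥ v - 1,
--   4k·W ≤ 4p²·W + 4k² + 8k.
-- If the claimed bound failed, 4k = 4p² + s with p - 1 ≤ s ≤ 16p³, and the last inequality
-- becomes the quadratic constraint 32p³s ≤ (4p² + s)² + 8(4p² + s) + 4s.  Bounding s² via
-- (s - (p - 1))(16p³ - s) ≥ 0 makes it linear in s, and the linear constraint fails for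
-- every p ≥ 4.

open import Defs
open import Level using (0ℓ)
open import Data.Bool using (Bool; true; false; _∧_; not)
open import Data.Nat using (ℕ; suc; _≤_; _+_; _*_; _^_; _≤?_; s≤s; z≤n; s≤s⁻¹)
open import Data.Nat.Properties hiding (_≟_)
open import Data.Nat.Primality using (Prime)
open import Data.Integer as ℤ using (ℤ; +_)
import Data.Integer.Properties as ℤP
open import Data.List using (List; []; _∷_; length; filter; cartesianProduct; map; _++_)
open import Data.List.Relation.Unary.All as All using (All; []; _∷_)
open import Data.List.Relation.Unary.AllPairs using (AllPairs; []; _∷_)
open import Data.Product using (_×_; _,_; proj₁; proj₂; ∃-syntax)
open import Data.Sum using (_⊎_; inj₁; inj₂)
open import Data.Empty using (⊥; ⊥-elim)
open import Relation.Nullary using (¬_; Dec; does; yes; no; _×-dec_; ¬?; contradiction)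
open import Relation.Unary using (Pred; Decidable)
open import Relation.Binary.PropositionalEquality
open import Algebra.Properties.CommutativeSemigroup +-commutativeSemigroup using (interchange)
import Data.Nat.Tactic.RingSolver as ℕ-Ring
import Data.Integer.Tactic.RingSolver as ℤ-Ring

∑ : {A : Set} → List A → (A → ℕ) → ℕ
∑ []       f = 0
∑ (x ∷ xs) f = f x + ∑ xs f

syntax ∑ xs (λ x → t) = ∑[ x ∈ xs ] t

bit : Bool → ℕ
bit true  = 1
bit false = 0

𝟙 : {A : Set} → Dec A → ℕ
𝟙 d = bit (does d)

module _ {A : Set} where

  ∑-cong : ∀ xs {f g : A → ℕ} → (∀ x → f x ≡ g x) → ∑ xs f ≡ ∑ xs g
  ∑-cong []       f≡g = refl
  ∑-cong (x ∷ xs) f≡g = cong₂ _+_ (f≡g x) (∑-cong xs f≡g)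

  ∑-mono : ∀ xs {f g : A → ℕ} → (∀ x → f x ≤ g x) → ∑ xs f ≤ ∑ xs g
  ∑-mono []       f≤g = z≤n
  ∑-mono (x ∷ xs) f≤g = +-mono-≤ (f≤g x) (∑-mono xs f≤g)

  ∑-zero : ∀ (xs : List A) → ∑[ x ∈ xs ] 0 ≡ 0
  ∑-zero []       = refl
  ∑-zero (x ∷ xs) = ∑-zero xs

  ∑-one : ∀ (xs : List A) → ∑[ x ∈ xs ] 1 ≡ length xs
  ∑-one []       = refl
  ∑-one (x ∷ xs) = cong suc (∑-one xs)

  ∑-+ : ∀ xs (f g : A → ℕ) → ∑[ x ∈ xs ] (f x + g x) ≡ ∑ xs f + ∑ xs g
  ∑-+ []       f g = refl
  ∑-+ (x ∷ xs) f g = trans (cong (_+_ (f x + g x)) (∑-+ xs f g)) (interchange (f x) (g x) (∑ xs f) (∑ xs g))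

  ∑-scale : ∀ xs c (f : A → ℕ) → ∑[ x ∈ xs ] (c * f x) ≡ c * ∑ xs f
  ∑-scale []       c f = sym (*-zeroʳ c)
  ∑-scale (x ∷ xs) c f = trans (cong (_+_ (c * f x)) (∑-scale xs c f)) (sym (*-distribˡ-+ c (f x) (∑ xs f)))

  ∑-++ : ∀ xs ys (f : A → ℕ) → ∑ (xs ++ ys) f ≡ ∑ xs f + ∑ ys f
  ∑-++ []       ys f = refl
  ∑-++ (x ∷ xs) ys f = trans (cong (_+_ (f x)) (∑-++ xs ys f)) (sym (+-assoc (f x) (∑ xs f) (∑ ys f)))

  length-filter : ∀ {P : Pred A 0ℓ} (P? : Decidable P) xs → length (filter P? xs) ≡ ∑[ x ∈ xs ] 𝟙 (P? x)
  length-filter P? []       = refl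
  length-filter P? (x ∷ xs) with does (P? x)
  ... | true  = cong suc (length-filter P? xs)
  ... | false = length-filter P? xs

  ∑-𝟙-unique : ∀ (_≈_ : A → A → Set) {Q : Pred A 0ℓ} (Q? : Decidable Q) →
    (∀ {x y} → Q x → Q y → x ≈ y) →
    ∀ xs → AllPairs (λ a b → ¬ (a ≈ b)) xs → ∑[ x ∈ xs ] 𝟙 (Q? x) ≤ 1
  ∑-𝟙-unique _≈_ {Q} Q? unique []       []               = z≤n
  ∑-𝟙-unique _≈_ {Q} Q? unique (x ∷ xs) (x≉xs ∷ distinct) with Q? x
  ... | yes Qx = ≤-reflexive (cong suc (none xs (All.map (λ x≉y Qy → x≉y (unique Qx Qy)) x≉xs)))
    where
    none : ∀ ys → All (λ y → ¬ Q y) ys → ∑[ y ∈ ys ] 𝟙 (Q? y) ≡ 0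
    none []       []            = refl
    none (y ∷ ys) (¬Qy ∷ ¬Qys) with Q? y
    ... | yes Qy = contradiction Qy ¬Qy
    ... | no  _  = none ys ¬Qys
  ... | no _ = ∑-𝟙-unique _≈_ Q? unique xs distinct

∑-map : ∀ {A B : Set} (g : A → B) xs (f : B → ℕ) → ∑ (map g xs) f ≡ ∑[ x ∈ xs ] f (g x)
∑-map g []       f = refl
∑-map g (x ∷ xs) f = cong (_+_ (f (g x))) (∑-map g xs f)

∑-swap : ∀ {A B : Set} (xs : List A) (ys : List B) (h : A → B → ℕ) →
  ∑[ x ∈ xs ] ∑ ys (h x) ≡ ∑[ y ∈ ys ] ∑[ x ∈ xs ] h x y
∑-swap []       ys h = sym (∑-zero ys)
∑-swap (x ∷ xs) ys h =
  trans (cong (_+_ (∑ ys (h x))) (∑-swap xs ys h)) (sym (∑-+ ys (h x) (λ y → ∑[ x ∈ xs ] h x y)))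

∑-cartesianProduct : ∀ {A B : Set} (xs : List A) (ys : List B) (f : A → ℕ) (g : B → ℕ) →
  ∑[ z ∈ cartesianProduct xs ys ] (f (proj₁ z) * g (proj₂ z)) ≡ ∑ xs f * ∑ ys g
∑-cartesianProduct []       ys f g = refl
∑-cartesianProduct (x ∷ xs) ys f g = begin
  ∑ (map (x ,_) ys ++ cartesianProduct xs ys) F       ≡⟨ ∑-++ (map (x ,_) ys) (cartesianProduct xs ys) F ⟩
  ∑ (map (x ,_) ys) F + ∑ (cartesianProduct xs ys) F  ≡⟨ cong₂ _+_ (trans (∑-map (x ,_) ys F) (∑-scale ys (f x) g))
                                                                    (∑-cartesianProduct xs ys f g) ⟩
  f x * ∑ ys g + ∑ xs f * ∑ ys g                      ≡⟨ *-distribʳ-+ (∑ ys g) (f x) (∑ xs f) ⟨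
  (f x + ∑ xs f) * ∑ ys g                             ∎
  where
  open ≡-Reasoning
  F = λ z → f (proj₁ z) * g (proj₂ z)

bit-∧-drop : ∀ b₁ b₂ b₃ b₄ → bit (b₁ ∧ (b₂ ∧ (b₃ ∧ b₄))) ≤ bit b₁ * bit b₂ * bit b₄
bit-∧-drop false b₂    b₃    b₄    = z≤n
bit-∧-drop true  false b₃    b₄    = z≤n
bit-∧-drop true  true  false b₄    = z≤n
bit-∧-drop true  true  true  true  = s≤s z≤n
bit-∧-drop true  true  true  false = z≤n

bit-cover : ∀ b₁ b₂ → 1 ≤ bit b₁ + bit (not b₁ ∧ not b₂) + bit b₂
bit-cover true  b₂    = s≤s z≤n
bit-cover false true  = s≤s z≤n
bit-cover false false = s≤s z≤n

module DoubleCounting (G : FiniteAbelianGroup) (D : Subset G) where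
  open FiniteAbelianGroup G using (Carrier; _≈_; _∙_; _⁻¹; ε; _≟_; elems; distinct; order) renaming (sym to ≈-sym; trans to ≈-trans)
  open Subset D

  pairs : List (Carrier × Carrier)
  pairs = cartesianProduct elems elems

  Represents : Carrier → Carrier × Carrier → Set
  Represents x (g , h) = mem g × mem h × ¬ (g ≈ h) × ((g ∙ h ⁻¹) ≈ x)

  represents? : ∀ x → Decidable (Represents x)
  represents? x (g , h) = mem? g ×-dec mem? h ×-dec ¬? (g ≟ h) ×-dec ((g ∙ h ⁻¹) ≟ x)

  size-∑ : size D ≡ ∑[ x ∈ elems ] 𝟙 (mem? x)
  size-∑ = length-filter mem? elems

  represented-once : ∀ z → ∑[ x ∈ elems ] 𝟙 (represents? x z) ≤ 𝟙 (mem? (proj₁ z)) * 𝟙 (mem? (proj₂ z))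
  represented-once (g , h) = begin
    ∑[ x ∈ elems ] 𝟙 (represents? x (g , h))  ≤⟨ ∑-mono elems forget-g≠h ⟩
    ∑[ x ∈ elems ] (c * 𝟙 ((g ∙ h ⁻¹) ≟ x))   ≡⟨ ∑-scale elems c (λ x → 𝟙 ((g ∙ h ⁻¹) ≟ x)) ⟩
    c * ∑[ x ∈ elems ] 𝟙 ((g ∙ h ⁻¹) ≟ x)     ≤⟨ *-monoʳ-≤ c (∑-𝟙-unique _≈_ ((g ∙ h ⁻¹) ≟_) (λ p q → ≈-trans (≈-sym p) q) elems distinct) ⟩
    c * 1                                    ≡⟨ *-identityʳ c ⟩
    c                                        ∎
    where
    open ≤-Reasoning
    c = 𝟙 (mem? g) * 𝟙 (mem? h)
    forget-g≠h : ∀ x → 𝟙 (represents? x (g , h)) ≤ c * 𝟙 ((g ∙ h ⁻¹) ≟ x)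
    forget-g≠h x = bit-∧-drop (does (mem? g)) (does (mem? h)) (does (¬? (g ≟ h))) (does ((g ∙ h ⁻¹) ≟ x))

  -- Σₓ reps(x) ≤ k²: each ordered pair in D × D is counted at most once.
  ∑-reps≤ : ∑ elems (reps D) ≤ size D * size D
  ∑-reps≤ = begin
    ∑ elems (reps D)                                          ≡⟨ ∑-cong elems (λ x → length-filter (represents? x) pairs) ⟩
    ∑[ x ∈ elems ] ∑[ z ∈ pairs ] 𝟙 (represents? x z)         ≡⟨ ∑-swap elems pairs (λ x z → 𝟙 (represents? x z)) ⟩
    ∑[ z ∈ pairs ] ∑[ x ∈ elems ] 𝟙 (represents? x z)         ≤⟨ ∑-mono pairs represented-once ⟩
    ∑[ z ∈ pairs ] (𝟙 (mem? (proj₁ z)) * 𝟙 (mem? (proj₂ z)))  ≡⟨ ∑-cartesianProduct elems elems _ _ ⟩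
    ∑[ x ∈ elems ] 𝟙 (mem? x) * ∑[ x ∈ elems ] 𝟙 (mem? x)     ≡⟨ cong₂ _*_ size-∑ size-∑ ⟨
    size D * size D                                           ∎
    where open ≤-Reasoning

  Outside : Carrier → Set
  Outside x = ¬ mem x × ¬ (x ≈ ε)

  outside? : Decidable Outside
  outside? x = ¬? (mem? x) ×-dec ¬? (x ≟ ε)

  c : ℕ
  c = ∑[ x ∈ elems ] 𝟙 (outside? x)

  -- |G| ≤ k + c + 1, since G = D ∪ {e} ∪ (outside).
  order≤ : order ≤ size D + c + 1
  order≤ = begin
    length elems                                                           ≡⟨ ∑-one elems ⟨
    ∑[ x ∈ elems ] 1                                                       ≤⟨ ∑-mono elems (λ x → bit-cover (does (mem? x)) (does (x ≟ ε))) ⟩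
    ∑[ x ∈ elems ] (𝟙 (mem? x) + 𝟙 (outside? x) + 𝟙 (x ≟ ε))               ≡⟨ ∑-+ elems _ _ ⟩
    ∑[ x ∈ elems ] (𝟙 (mem? x) + 𝟙 (outside? x)) + ∑[ x ∈ elems ] 𝟙 (x ≟ ε) ≡⟨ cong (_+ _) (∑-+ elems _ _) ⟩
    ∑[ x ∈ elems ] 𝟙 (mem? x) + c + ∑[ x ∈ elems ] 𝟙 (x ≟ ε)               ≤⟨ +-mono-≤ (≤-reflexive (cong (_+ c) (sym size-∑)))
                                                                                (∑-𝟙-unique _≈_ (_≟ ε) (λ p q → ≈-trans p (≈-sym q)) elems distinct) ⟩
    size D + c + 1                                                         ∎
    where open ≤-Reasoning

  -- For a regular PDS every x ∈ D is represented λ times and every x outside D ∪ {e}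
  -- μ times, so Σₓ reps(x) ≥ λk + μc.
  module _ {l μ : ℕ} (on-D : ∀ x → ¬ (x ≈ ε) → mem x → reps D x ≡ l)
                     (off-D : ∀ x → ¬ (x ≈ ε) → ¬ mem x → reps D x ≡ μ) (ε∉D : ¬ mem ε) where

    expected≤reps : ∀ x → l * 𝟙 (mem? x) + μ * 𝟙 (outside? x) ≤ reps D x
    expected≤reps x with mem? x
    ... | yes x∈D = ≤-reflexive (begin
      l * 1 + μ * 0 ≡⟨ cong₂ _+_ (*-identityʳ l) (*-zeroʳ μ) ⟩
      l + 0         ≡⟨ +-identityʳ l ⟩
      l             ≡⟨ on-D x (λ x≈ε → ε∉D (respects x≈ε x∈D)) x∈D ⟨
      reps D x      ∎)
      where open ≡-Reasoning
    ... | no x∉D with x ≟ ε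
    ...   | yes _   = ≤-trans (≤-reflexive (cong₂ _+_ (*-zeroʳ l) (*-zeroʳ μ))) z≤n
    ...   | no x≉ε = ≤-reflexive (begin
      l * 0 + μ * 1 ≡⟨ cong₂ _+_ (*-zeroʳ l) (*-identityʳ μ) ⟩
      μ             ≡⟨ off-D x x≉ε x∉D ⟨
      reps D x      ∎)
      where open ≡-Reasoning

    ∑-reps≥ : l * size D + μ * c ≤ ∑ elems (reps D)
    ∑-reps≥ = begin
      l * size D + μ * c                                                  ≡⟨ cong (λ k → l * k + μ * c) size-∑ ⟩
      l * ∑[ x ∈ elems ] 𝟙 (mem? x) + μ * c                               ≡⟨ cong₂ _+_ (∑-scale elems l _) (∑-scale elems μ _) ⟨
      ∑[ x ∈ elems ] (l * 𝟙 (mem? x)) + ∑[ x ∈ elems ] (μ * 𝟙 (outside? x)) ≡⟨ ∑-+ elems _ _ ⟨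
      ∑[ x ∈ elems ] (l * 𝟙 (mem? x) + μ * 𝟙 (outside? x))                ≤⟨ ∑-mono elems expected≤reps ⟩
      ∑ elems (reps D)                                                    ∎
      where open ≤-Reasoning

pds-counting : ∀ {G : FiniteAbelianGroup} {D : Subset G} {v k l μ} →
  IsPDS D v k l μ → IsRegular D → ∃[ c ] (l * k + μ * c ≤ k * k × v ≤ k + c + 1)
pds-counting {G} {D} (refl , refl , on-D , off-D) (_ , ε∉D) =
  c , ≤-trans (∑-reps≥ on-D off-D ε∉D) ∑-reps≤ , order≤
  where open DoubleCounting G D

Δ : ℕ → ℕ → ℕ → ℤ
Δ l μ k = ((+ l) ℤ.- (+ μ)) ℤ.* ((+ l) ℤ.- (+ μ)) ℤ.+ (+ 4) ℤ.* ((+ k) ℤ.- (+ μ))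

square-of-distance : ∀ a d →
  (+ (a + d) ℤ.- + a) ℤ.* (+ (a + d) ℤ.- + a) ≡ + (d * d) ×
  (+ a ℤ.- + (a + d)) ℤ.* (+ a ℤ.- + (a + d)) ≡ + (d * d)
square-of-distance a d =
  trans (up (+ a) (+ d)) (sym (ℤP.pos-* d d)) , trans (down (+ a) (+ d)) (sym (ℤP.pos-* d d))
  where
  up : ∀ x y → ((x ℤ.+ y) ℤ.- x) ℤ.* ((x ℤ.+ y) ℤ.- x) ≡ y ℤ.* y
  up = ℤ-Ring.solve-∀
  down : ∀ x y → (x ℤ.- (x ℤ.+ y)) ℤ.* (x ℤ.- (x ℤ.+ y)) ≡ y ℤ.* y
  down = ℤ-Ring.solve-∀

Δ-equation-in-ℕ : ∀ {P l μ k} d → ((+ l) ℤ.- (+ μ)) ℤ.* ((+ l) ℤ.- (+ μ)) ≡ + (d * d) →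
  Δ l μ k ≡ + (4 * P) → d * d + 4 * k ≡ 4 * P + 4 * μ
Δ-equation-in-ℕ {P} {l} {μ} {k} d square Δ≡ = ℤP.+-injective (begin
  + (d * d) ℤ.+ + (4 * k)                                      ≡⟨ cong (λ t → + (d * d) ℤ.+ t) (ℤP.pos-* 4 k) ⟩
  + (d * d) ℤ.+ (+ 4) ℤ.* (+ k)                                ≡⟨ split-off-μ (+ (d * d)) (+ k) (+ μ) ⟩
  (+ (d * d) ℤ.+ (+ 4) ℤ.* (+ k ℤ.- + μ)) ℤ.+ (+ 4) ℤ.* (+ μ)   ≡⟨ cong₂ ℤ._+_ Δ≡′ (sym (ℤP.pos-* 4 μ)) ⟩
  + (4 * P) ℤ.+ + (4 * μ)                                      ∎)
  where
  open ≡-Reasoning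
  Δ≡′ : + (d * d) ℤ.+ (+ 4) ℤ.* ((+ k) ℤ.- (+ μ)) ≡ + (4 * P)
  Δ≡′ = trans (cong (ℤ._+ ((+ 4) ℤ.* ((+ k) ℤ.- (+ μ)))) (sym square)) Δ≡
  split-off-μ : ∀ x y z → x ℤ.+ (+ 4) ℤ.* y ≡ (x ℤ.+ (+ 4) ℤ.* (y ℤ.- z)) ℤ.+ (+ 4) ℤ.* z
  split-off-μ = ℤ-Ring.solve-∀

Δ-natural : ∀ {P l μ k} → Δ l μ k ≡ + (4 * P) →
  ∃[ d ] (d * d + 4 * k ≡ 4 * P + 4 * μ × (l ≡ μ + d ⊎ μ ≡ l + d))
Δ-natural {P} {l} {μ} {k} Δ≡ with ≤-total μ l
... | inj₁ μ≤l with m≤n⇒∃[o]m+o≡n μ≤l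
...   | d , refl = d , Δ-equation-in-ℕ {P} {μ + d} {μ} {k} d (proj₁ (square-of-distance μ d)) Δ≡ , inj₁ refl
Δ-natural {P} {l} {μ} {k} Δ≡ | inj₂ l≤μ with m≤n⇒∃[o]m+o≡n l≤μ
...   | d , refl = d , Δ-equation-in-ℕ {P} {l} {l + d} {k} d (proj₂ (square-of-distance l d)) Δ≡ , inj₂ refl

-- The cross term 4dk is absorbed by d²W + 8k as soon as W ≥ 2k - 1 and k ≥ 2:
-- for d ≤ 2 by 8k, for d ≥ 3 by d²W ≥ 3dW ≥ 2d(W + 1) ≥ 4dk.
cross-term : ∀ d k W → 2 ≤ k → 2 * k ≤ W + 1 → 4 * (d * k) ≤ d * d * W + 8 * k
cross-term d k W k≥2 2k≤W+1 with d ≤? 2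
... | yes d≤2 = begin
  4 * (d * k)  ≡⟨ sym (*-assoc 4 d k) ⟩
  4 * d * k    ≤⟨ *-monoˡ-≤ k (*-monoʳ-≤ 4 d≤2) ⟩
  8 * k        ≤⟨ m≤n+m (8 * k) (d * d * W) ⟩
  d * d * W + 8 * k ∎
  where open ≤-Reasoning
... | no d≰2 = begin
  4 * (d * k)          ≡⟨ regroup d k ⟩
  2 * d * (2 * k)      ≤⟨ *-monoʳ-≤ (2 * d) 2k≤W+1 ⟩
  2 * d * (W + 1)      ≡⟨ distribute d W ⟩
  2 * d * W + d * 2    ≤⟨ +-monoʳ-≤ (2 * d * W) (*-monoʳ-≤ d W≥2) ⟩
  2 * d * W + d * W    ≡⟨ collect d W ⟩
  3 * d * W            ≤⟨ *-monoˡ-≤ W (*-monoˡ-≤ d (≰⇒> d≰2)) ⟩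
  d * d * W            ≤⟨ m≤m+n (d * d * W) (8 * k) ⟩
  d * d * W + 8 * k ∎
  where
  open ≤-Reasoning
  W≥2 : 2 ≤ W
  W≥2 = +-cancelʳ-≤ 1 2 W (≤-trans (n≤1+n 3) (≤-trans (*-monoʳ-≤ 2 k≥2) 2k≤W+1))
  regroup : ∀ d k → 4 * (d * k) ≡ 2 * d * (2 * k)
  regroup = ℕ-Ring.solve-∀
  distribute : ∀ d W → 2 * d * (W + 1) ≡ 2 * d * W + d * 2
  distribute = ℕ-Ring.solve-∀
  collect : ∀ d W → 2 * d * W + d * W ≡ 3 * d * W
  collect = ℕ-Ring.solve-∀

weighted : ∀ {P k μ d} W → d * d + 4 * k ≡ 4 * P + 4 * μ →
  d * d * W + 4 * k * W ≡ 4 * P * W + 4 * (μ * W)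
weighted {P} {k} {μ} {d} W eq = begin
  d * d * W + 4 * k * W   ≡⟨ sym (*-distribʳ-+ W (d * d) (4 * k)) ⟩
  (d * d + 4 * k) * W     ≡⟨ cong (_* W) eq ⟩
  (4 * P + 4 * μ) * W     ≡⟨ expand P μ W ⟩
  4 * P * W + 4 * (μ * W) ∎
  where
  open ≡-Reasoning
  expand : ∀ P μ W → (4 * P + 4 * μ) * W ≡ 4 * P * W + 4 * (μ * W)
  expand = ℕ-Ring.solve-∀

-- If λ ≥ μ this is immediate since μW ≤ λk + μc; if μ = λ + d the extra term 4dk is
-- absorbed by the cross-term estimate.
key-inequality : ∀ {P k c l μ} → 2 ≤ k → 2 * k ≤ k + c + 1 → l * k + μ * c ≤ k * k →
  Δ l μ k ≡ + (4 * P) → 4 * k * (k + c) ≤ 4 * P * (k + c) + 4 * (k * k) + 8 * k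
key-inequality {P} {k} {c} {l} {μ} k≥2 2k≤W+1 counted Δ≡ with Δ-natural {P} {l} {μ} {k} Δ≡
... | d , relation , inj₁ refl = begin
  4 * k * W                       ≤⟨ m≤n+m (4 * k * W) (d * d * W) ⟩
  d * d * W + 4 * k * W           ≡⟨ weighted {P} {k} {μ} {d} W relation ⟩
  4 * P * W + 4 * (μ * W)         ≤⟨ +-monoʳ-≤ (4 * P * W) (*-monoʳ-≤ 4 μW≤k²) ⟩
  4 * P * W + 4 * (k * k)         ≤⟨ m≤m+n (4 * P * W + 4 * (k * k)) (8 * k) ⟩
  4 * P * W + 4 * (k * k) + 8 * k ∎
  where
  open ≤-Reasoning
  W = k + c
  μW≤k² : μ * W ≤ k * k
  μW≤k² = begin
    μ * (k + c)         ≡⟨ *-distribˡ-+ μ k c ⟩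
    μ * k + μ * c       ≤⟨ +-monoˡ-≤ (μ * c) (*-monoˡ-≤ k (m≤m+n μ d)) ⟩
    (μ + d) * k + μ * c ≤⟨ counted ⟩
    k * k               ∎
... | d , relation , inj₂ refl = +-cancelˡ-≤ (d * d * W) _ _ (begin
  d * d * W + 4 * k * W                         ≡⟨ weighted {P} {k} {l + d} {d} W relation ⟩
  4 * P * W + 4 * ((l + d) * W)                 ≤⟨ +-monoʳ-≤ (4 * P * W) (*-monoʳ-≤ 4 μW≤k²+dk) ⟩
  4 * P * W + 4 * (k * k + d * k)               ≡⟨ split (4 * P * W) (k * k) (d * k) ⟩
  4 * P * W + 4 * (k * k) + 4 * (d * k)         ≤⟨ +-monoʳ-≤ (4 * P * W + 4 * (k * k)) (cross-term d k W k≥2 2k≤W+1) ⟩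
  4 * P * W + 4 * (k * k) + (d * d * W + 8 * k) ≡⟨ rotate (4 * P * W + 4 * (k * k)) (d * d * W) (8 * k) ⟩
  d * d * W + (4 * P * W + 4 * (k * k) + 8 * k) ∎)
  where
  open ≤-Reasoning
  W = k + c
  regroup : ∀ l d k c → (l + d) * (k + c) ≡ (l * k + (l + d) * c) + d * k
  regroup = ℕ-Ring.solve-∀
  μW≤k²+dk : (l + d) * W ≤ k * k + d * k
  μW≤k²+dk = begin
    (l + d) * (k + c)             ≡⟨ regroup l d k c ⟩
    (l * k + (l + d) * c) + d * k ≤⟨ +-monoˡ-≤ (d * k) counted ⟩
    k * k + d * k                 ∎
  split : ∀ x y z → x + 4 * (y + z) ≡ x + 4 * y + 4 * z
  split = ℕ-Ring.solve-∀
  rotate : ∀ x y z → x + (y + z) ≡ y + (x + z)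
  rotate = ℕ-Ring.solve-∀

excess-bound : ∀ {P N k W s} → 4 * k ≡ 4 * P + s →
  4 * k * W ≤ 4 * P * W + 4 * (k * k) + 8 * k → 8 * N ≤ W + 1 →
  32 * N * s ≤ (4 * P + s) * (4 * P + s) + 8 * (4 * P + s) + 4 * s
excess-bound {P} {N} {k} {W} {s} 4k≡ key 8N≤W+1 = begin
  32 * N * s                                         ≡⟨ regroup N s ⟩
  4 * s * (8 * N)                                    ≤⟨ *-monoʳ-≤ (4 * s) 8N≤W+1 ⟩
  4 * s * (W + 1)                                    ≡⟨ distribute s W ⟩
  4 * (s * W) + 4 * s                                ≤⟨ +-monoˡ-≤ (4 * s) (*-monoʳ-≤ 4 sW≤) ⟩
  4 * (4 * (k * k) + 8 * k) + 4 * s                  ≡⟨ cong (_+ 4 * s) (in-terms-of-4k k) ⟩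
  (4 * k) * (4 * k) + 8 * (4 * k) + 4 * s            ≡⟨ cong (λ K → K * K + 8 * K + 4 * s) 4k≡ ⟩
  (4 * P + s) * (4 * P + s) + 8 * (4 * P + s) + 4 * s ∎
  where
  open ≤-Reasoning
  regroup : ∀ N s → 32 * N * s ≡ 4 * s * (8 * N)
  regroup = ℕ-Ring.solve-∀
  distribute : ∀ s W → 4 * s * (W + 1) ≡ 4 * (s * W) + 4 * s
  distribute = ℕ-Ring.solve-∀
  in-terms-of-4k : ∀ k → 4 * (4 * (k * k) + 8 * k) ≡ (4 * k) * (4 * k) + 8 * (4 * k)
  in-terms-of-4k = ℕ-Ring.solve-∀
  sW≤ : s * W ≤ 4 * (k * k) + 8 * k
  sW≤ = +-cancelˡ-≤ (4 * P * W) _ _ (begin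
    4 * P * W + s * W                 ≡⟨ sym (*-distribʳ-+ W (4 * P) s) ⟩
    (4 * P + s) * W                   ≡⟨ cong (_* W) (sym 4k≡) ⟩
    4 * k * W                         ≤⟨ key ⟩
    4 * P * W + 4 * (k * k) + 8 * k   ≡⟨ +-assoc (4 * P * W) (4 * (k * k)) (8 * k) ⟩
    4 * P * W + (4 * (k * k) + 8 * k) ∎)

-- For a ≤ s ≤ b we have (s - a)(b - s) ≥ 0, i.e. s² + ab ≤ (a + b)s.
between-square : ∀ {a s b} → a ≤ s → s ≤ b → s * s + a * b ≤ (a + b) * s
between-square {a} a≤s s≤b with m≤n⇒∃[o]m+o≡n a≤s
... | e , refl with m≤n⇒∃[o]m+o≡n s≤b
...   | t , refl = begin
  (a + e) * (a + e) + a * (a + e + t)          ≤⟨ m≤m+n _ (e * t) ⟩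
  (a + e) * (a + e) + a * (a + e + t) + e * t  ≡⟨ product-identity a e t ⟩
  (a + (a + e + t)) * (a + e)                  ∎
  where
  open ≤-Reasoning
  product-identity : ∀ a e t → (a + e) * (a + e) + a * (a + e + t) + e * t ≡ (a + (a + e + t)) * (a + e)
  product-identity = ℕ-Ring.solve-∀

-- Bounding s² by (s - a)(16p³ - s) ≥ 0, with a = p - 1 ≤ s, turns the quadratic
-- constraint into the linear one  16p³s ≤ 16p³ + 8p²s + 32p² + (12 + a)s.
quadratic⇒linear : ∀ {p a s} → 1 + a ≡ p → a ≤ s → s ≤ 16 * p ^ 3 →
  32 * p ^ 3 * s ≤ (4 * p ^ 2 + s) * (4 * p ^ 2 + s) + 8 * (4 * p ^ 2 + s) + 4 * s →
  16 * p ^ 3 * s ≤ 16 * p ^ 3 + 8 * p ^ 2 * s + 32 * p ^ 2 + (12 + a) * s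
quadratic⇒linear {p} {a} {s} refl a≤s s≤b quadratic = +-cancelˡ-≤ (16 * a * p ^ 3 + 16 * p ^ 3 * s) _ _ (begin
  16 * a * p ^ 3 + 16 * p ^ 3 * s + 16 * p ^ 3 * s                         ≡⟨ collect a (p ^ 3) s ⟩
  32 * p ^ 3 * s + a * b                                                   ≤⟨ +-monoˡ-≤ (a * b) quadratic ⟩
  (4 * p ^ 2 + s) * (4 * p ^ 2 + s) + 8 * (4 * p ^ 2 + s) + 4 * s + a * b ≡⟨ expand (p ^ 2) s (a * b) ⟩
  X + (s * s + a * b)                                                      ≤⟨ +-monoʳ-≤ X (between-square a≤s s≤b) ⟩
  X + (a + b) * s                                                          ≡⟨ regroup a s ⟩
  16 * a * p ^ 3 + 16 * p ^ 3 * s + (16 * p ^ 3 + 8 * p ^ 2 * s + 32 * p ^ 2 + (12 + a) * s) ∎)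
  where
  open ≤-Reasoning
  b X : ℕ
  b = 16 * p ^ 3
  X = 16 * (p ^ 2 * p ^ 2) + 8 * p ^ 2 * s + 32 * p ^ 2 + 12 * s
  collect : ∀ a P s → 16 * a * P + 16 * P * s + 16 * P * s ≡ 32 * P * s + a * (16 * P)
  collect = ℕ-Ring.solve-∀
  expand : ∀ P s c → (4 * P + s) * (4 * P + s) + 8 * (4 * P + s) + 4 * s + c
                   ≡ 16 * (P * P) + 8 * P * s + 32 * P + 12 * s + (s * s + c)
  expand = ℕ-Ring.solve-∀
  -- uses p⁴ = p³ · (1 + a)
  regroup : ∀ a s → let p = 1 + a; p² = p * (p * 1); p³ = p * p² in
    16 * (p² * p²) + 8 * p² * s + 32 * p² + 12 * s + (a + 16 * p³) * s
      ≡ 16 * a * p³ + 16 * p³ * s + (16 * p³ + 8 * p² * s + 32 * p² + (12 + a) * s)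
  regroup = ℕ-Ring.solve-∀

-- For p = 4 + q and s = (p - 1) + e the linear constraint fails: the difference of its
-- two sides is a polynomial in q and e with positive coefficients.
linear-impossible : ∀ q e → let p = 4 + q; p² = p * (p * 1); a = 3 + q; s = a + e in
  16 * (p * p²) * s ≤ 16 * (p * p²) + 8 * p² * s + 32 * p² + (12 + a) * s → ⊥
linear-impossible q e linear = m+1+n≰m rhs (≤-trans (≤-reflexive (sym (positive-gap q e))) linear)
  where
  p p² a s rhs : ℕ
  p = 4 + q
  p² = p * (p * 1)
  a = 3 + q
  s = a + e
  rhs = 16 * (p * p²) + 8 * p² * s + 32 * p² + (12 + a) * s
  positive-gap : ∀ q e → let p = 4 + q; p² = p * (p * 1); a = 3 + q; s = a + e in
    16 * (p * p²) * s
      ≡ 16 * (p * p²) + 8 * p² * s + 32 * p² + (12 + a) * s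
        + suc (1106 + 881 * e + 1966 * q + 703 * q * e + 1031 * q * q + 184 * q * q * e
               + 216 * q * q * q + 16 * q * q * q * e + 16 * q * q * q * q)
  positive-gap = ℕ-Ring.solve-∀

excess-impossible : ∀ {p s} → 4 ≤ p → p ≤ s + 1 → s ≤ 16 * p ^ 3 →
  32 * p ^ 3 * s ≤ (4 * p ^ 2 + s) * (4 * p ^ 2 + s) + 8 * (4 * p ^ 2 + s) + 4 * s → ⊥
excess-impossible {p} {s} p≥4 p≤s+1 s≤16p³ quadratic =
  linear-impossible q e (subst₂ Linear (sym 4+q≡p) (sym a+e≡s) linear)
  where
  q = proj₁ (m≤n⇒∃[o]m+o≡n p≥4)
  4+q≡p : 4 + q ≡ p
  4+q≡p = proj₂ (m≤n⇒∃[o]m+o≡n p≥4)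
  a = 3 + q
  a≤s : a ≤ s
  a≤s = +-cancelʳ-≤ 1 a s (≤-trans (≤-reflexive (trans (+-comm a 1) 4+q≡p)) p≤s+1)
  e = proj₁ (m≤n⇒∃[o]m+o≡n a≤s)
  a+e≡s : a + e ≡ s
  a+e≡s = proj₂ (m≤n⇒∃[o]m+o≡n a≤s)
  Linear : ℕ → ℕ → Set
  Linear p s = let p² = p * (p * 1) in 16 * (p * p²) * s ≤ 16 * (p * p²) + 8 * p² * s + 32 * p² + (12 + a) * s
  linear : Linear p s
  linear = quadratic⇒linear 4+q≡p a≤s s≤16p³ quadratic

excess-of-large-k : ∀ {P p k} → 1 ≤ p → ¬ (4 * k + 2 ≤ 4 * P + p) →
  ∃[ s ] (4 * k ≡ 4 * P + s × p ≤ s + 1)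
excess-of-large-k {P} {p} {k} p≥1 k-large =
  let s , 4P+s≡4k = m≤n⇒∃[o]m+o≡n 4P≤4k in
  s , sym 4P+s≡4k ,
  +-cancelˡ-≤ (4 * P) p (s + 1)
    (≤-trans 4P+p≤4k+1 (≤-reflexive (trans (cong (_+ 1) (sym 4P+s≡4k)) (+-assoc (4 * P) s 1))))
  where
  4P+p≤4k+1 : 4 * P + p ≤ 4 * k + 1
  4P+p≤4k+1 = s≤s⁻¹ (≤-trans (≰⇒> k-large) (≤-reflexive (+-suc (4 * k) 1)))
  4P≤4k : 4 * P ≤ 4 * k
  4P≤4k = +-cancelʳ-≤ 1 (4 * P) (4 * k) (≤-trans (+-monoʳ-≤ (4 * P) p≥1) 4P+p≤4k+1)

excess≤ : ∀ {P N k s} → 4 * k ≡ 4 * P + s → 2 * k ≤ 8 * N → s ≤ 16 * N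
excess≤ {P} {N} {k} {s} 4k≡ 2k≤8N = begin
  s           ≤⟨ m≤n+m s (4 * P) ⟩
  4 * P + s   ≡⟨ 4k≡ ⟨
  4 * k       ≡⟨ *-assoc 2 2 k ⟩
  2 * (2 * k) ≤⟨ *-monoʳ-≤ 2 2k≤8N ⟩
  2 * (8 * N) ≡⟨ *-assoc 2 8 N ⟨
  16 * N      ∎
  where open ≤-Reasoning

k≥2 : ∀ {p k s} → 4 ≤ p → 4 * k ≡ 4 * p ^ 2 + s → 2 ≤ k
k≥2 {p} {k} {s} p≥4 4k≡ = *-cancelˡ-≤ 4 (begin
  4 * 2         ≤⟨ *-monoʳ-≤ 4 (≤-trans (m≤m+n 2 14) 16≤p²) ⟩
  4 * p ^ 2     ≤⟨ m≤m+n (4 * p ^ 2) s ⟩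
  4 * p ^ 2 + s ≡⟨ 4k≡ ⟨
  4 * k         ∎)
  where
  open ≤-Reasoning
  16≤p² : 16 ≤ p ^ 2
  16≤p² = *-mono-≤ p≥4 (*-mono-≤ p≥4 (≤-refl {1}))

lemma3 : (p : ℕ) → Prime p → 5 ≤ p →
    (G : FiniteAbelianGroup) → (D : Subset G) → (v k λ' μ : ℕ) →
    IsPDS D v k λ' μ → IsRegular D → ¬ IsTrivial D →
    v ≡ 8 * p ^ 3 →
    (((+ λ') ℤ.- (+ μ)) ℤ.* ((+ λ') ℤ.- (+ μ)) ℤ.+ (+ 4) ℤ.* ((+ k) ℤ.- (+ μ))) ≡ + (4 * p ^ 2) →
    2 * k ≤ v →
    4 * k + 2 ≤ 4 * p ^ 2 + p
lemma3 p _ p≥5 G D v k λ' μ pds regular _ refl Δ≡ 2k≤v with 4 * k + 2 ≤? 4 * p ^ 2 + p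
... | yes bound  = bound
... | no ¬bound with pds-counting {G} {D} pds regular | excess-of-large-k {p ^ 2} {p} {k} (≤-trans (s≤s z≤n) p≥5) ¬bound
...   | c , counted , v≤W+1 | s , 4k≡ , p≤s+1 =
  ⊥-elim (excess-impossible p≥4 p≤s+1 (excess≤ {p ^ 2} {p ^ 3} {k} 4k≡ 2k≤v) quadratic)
  where
  p≥4 : 4 ≤ p
  p≥4 = ≤-trans (n≤1+n 4) p≥5
  key : 4 * k * (k + c) ≤ 4 * p ^ 2 * (k + c) + 4 * (k * k) + 8 * k
  key = key-inequality {p ^ 2} {k} {c} {λ'} {μ} (k≥2 p≥4 4k≡) (≤-trans 2k≤v v≤W+1) counted Δ≡
  quadratic : 32 * p ^ 3 * s ≤ (4 * p ^ 2 + s) * (4 * p ^ 2 + s) + 8 * (4 * p ^ 2 + s) + 4 * s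
  quadratic = excess-bound {p ^ 2} {p ^ 3} {k} {k + c} 4k≡ key v≤W+1
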